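{- Let $n\ge 2$ and let $\mathbf a=1\,2\cdots n$ and $\mathbf b=n\,(n-1)\cdots 1$ be vertices of $G(n)$. Then (a) $\mathbf a$ and $\mathbf b$ are the only vertices of $G(n)$ contained in a $1$-cycle; and (b) for every integer $k$ with $2\le k<n$, neither $\mathbf a$ nor $\mathbf b$ is contained in a $k$-cycle of $G(n)$.
   Context: For a sequence of distinct integers $c_1\cdots c_t$, $\mathrm{st}(c_1\cdots c_t)$ is the unique permutation $d_1\cdots d_t$ of $\{1,\dots,t\}$ with $d_i<d_j$ iff $c_i<c_j$. $G(n)$ is the directed multigraph whose vertices are the permutations of $\{1,\dots,n\}$ (one-line notation) and whose edges are the permutations $c_1\cdots c_{n+1}$ of $\{1,\dots,n+1\}$, the edge $c_1\cdots c_{n+1}$ going from $\mathrm{st}(c_1\cdots c_n)$ to $\mathrm{st}(c_2\cdots c_{n+1})$; so there is an edge from $x_1\cdots x_n$ to $w_1\cdots w_n$ iff $\mathrm{st}(x_2\cdots x_n)=\mathrm{st}(w_1\cdots w_{n-1})$. A closed $k$-walk $(v_1,\dots,v_k)$ is a sequence of vertices with an edge from $v_i$ to $v_{i+1}$ for $i<k$ and from $v_k$ to $v_1$; it is a $k$-cycle if $v_1,\dots,v_k$ are pairwise distinct (a $1$-cycle is a loop). -}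

module Defs where

open import Data.Nat using (ℕ; zero; suc; _<?_)
open import Data.Fin using (Fin; zero; suc; inject₁; fromℕ)
open import Data.List using (List; map; filter; length; take; drop; upTo; reverse)
open import Data.List.Relation.Binary.Permutation.Propositional using (_↭_)
open import Data.Product using (Σ; ∃; _×_)
open import Data.Empty using (⊥)
open import Function.Definitions using (Injective)
open import Relation.Binary.PropositionalEquality using (_≡_)

-- Permutations in one-line notation are lists of naturals.
-- xs is a permutation of {1,…,n}
IsPerm : ℕ → List ℕ → Set
IsPerm n xs = xs ↭ map suc (upTo n)

-- standardization: the entry c_i is replaced by 1 + #{ j : c_j < c_i }
-- (for sequences of distinct integers this is exactly st)
st : List ℕ → List ℕ
st cs = map (λ c → suc (length (filter (_<? c) cs))) cs

Edge : ℕ → List ℕ → List ℕ → Set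
Edge n x w = ∃ λ c → IsPerm (suc n) c × st (take n c) ≡ x × st (drop 1 c) ≡ w

-- v : Fin (suc m) → vertices is a closed (m+1)-walk in G(n)
IsClosedWalk : (n m : ℕ) → (Fin (suc m) → List ℕ) → Set
IsClosedWalk n m v =
  (∀ i → IsPerm n (v i)) ×
  (∀ (i : Fin m) → Edge n (v (inject₁ i)) (v (suc i))) ×
  Edge n (v (fromℕ m)) (v zero)

IsCycle : (n m : ℕ) → (Fin (suc m) → List ℕ) → Set
IsCycle n m v = IsClosedWalk n m v × Injective _≡_ _≡_ v

InCycle : (n k : ℕ) → List ℕ → Set
InCycle n zero x = ⊥
InCycle n (suc m) x = Σ (Fin (suc m) → List ℕ) λ v → IsCycle n m v × ∃ λ i → v i ≡ x

idPerm : ℕ → List ℕ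
idPerm n = map suc (upTo n)

revPerm : ℕ → List ℕ
revPerm n = reverse (idPerm n)

module Submission where

-- The proof works with the up-down pattern of a sequence (ascent/descent of each
-- adjacent pair).  Standardization preserves it, so an edge c from x to w makes
-- the patterns of x and w the first and the last n-1 letters of the pattern of c
-- ('edge-shift'); and a permutation with constant pattern is monotone, hence is
-- 1 2 ⋯ n or n ⋯ 2 1 ('constant-perm').
-- (a) For a loop the two windows coincide, forcing a constant pattern; conversely
--     both monotone permutations carry a loop ('monotone-loop').
-- (b) Unroll a k-cycle through a monotone x into a k-periodic walk ('orbit').  A
--     constant pattern spreads backwards one position per step and forwards one
--     step; for k < n this makes the successor of x constant too ('constant-next'),
--     so it equals x, contradicting distinctness of the cycle's vertices.

open import Defs
open import Data.Nat using (ℕ; zero; suc; _+_; _∸_; _≤_; _<_; _<?_; z≤n; s≤s; s≤s⁻¹)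
open import Data.Nat.Properties
open import Data.Bool using (Bool; true; false; T)
open import Data.Unit using (tt)
open import Data.Fin using (Fin; zero; suc; toℕ; inject₁; fromℕ)
open import Data.Fin.Properties using (toℕ-injective; toℕ-inject₁; toℕ-fromℕ; toℕ<n)
open import Data.List using (List; []; _∷_; map; filter; length; take; drop; reverse; upTo; applyUpTo; applyDownFrom)
open import Data.List.Properties using (filter-accept; filter-reject; map-upTo; map-applyDownFrom; reverse-applyUpTo; map-id-local; map-cong; map-∘; take-drop; drop-drop; take-[]; ∷-injective)
open import Data.List.Relation.Unary.All as All using (All; []; _∷_)
open import Data.List.Relation.Unary.All.Properties using (drop⁺; take⁺; applyUpTo⁺₁) renaming (map⁺ to All-map⁺)
open import Data.List.Relation.Unary.Any using (here; there)
open import Data.List.Membership.Propositional using (_∈_)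
open import Data.List.Relation.Unary.Linked as Linked using (Linked; []; [-]; _∷_)
open import Data.List.Relation.Binary.Permutation.Propositional using (_↭_; ↭-refl; ↭-sym; ↭-trans; ↭⇒↭ₛ)
open import Data.List.Relation.Binary.Permutation.Propositional.Properties using (↭-length; ↭-reverse; filter-↭; All-resp-↭)
open import Data.List.Relation.Unary.Sorted.TotalOrder.Properties using (↗↭↗⇒≋)
open import Data.List.Relation.Binary.Equality.Propositional using (≋⇒≡)
import Relation.Binary.Properties.TotalOrder as TotalOrderProperties
open import Data.Product using (∃; _×_; _,_)
open import Data.Sum using (_⊎_; inj₁; inj₂)
open import Relation.Nullary using (¬_; yes; no; does; contradiction)
open import Relation.Nullary.Decidable using (dec-true; dec-false)
open import Relation.Binary.PropositionalEquality
open import Function.Base using (_∘_)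
open import Function.Bundles using (_⇔_; mk⇔)
open import Function.Construct.Composition using (_⇔-∘_)

below : List ℕ → ℕ → ℕ
below L c = length (filter (_<? c) L)

below-∷-< : ∀ L {y c} → y < c → below (y ∷ L) c ≡ suc (below L c)
below-∷-< L {c = c} y<c = cong length (filter-accept (_<? c) y<c)

below-∷-≮ : ∀ L {y c} → ¬ y < c → below (y ∷ L) c ≡ below L c
below-∷-≮ L {c = c} y≮c = cong length (filter-reject (_<? c) y≮c)

below-zero : ∀ L → below L 0 ≡ 0
below-zero [] = refl
below-zero (y ∷ L) = trans (below-∷-≮ L {y} λ ()) (below-zero L)

below-mono : ∀ L {a b} → a ≤ b → below L a ≤ below L b
below-mono [] a≤b = z≤n
below-mono (y ∷ L) {a} {b} a≤b with y <? a | y <? b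
... | yes y<a | yes y<b rewrite below-∷-< L y<a | below-∷-< L y<b = s≤s (below-mono L a≤b)
... | yes y<a | no y≮b = contradiction (<-≤-trans y<a a≤b) y≮b
... | no y≮a | yes y<b rewrite below-∷-≮ L y≮a | below-∷-< L y<b = m≤n⇒m≤1+n (below-mono L a≤b)
... | no y≮a | no y≮b rewrite below-∷-≮ L y≮a | below-∷-≮ L y≮b = below-mono L a≤b

-- an entry a of L is counted below every b > a, so below L is strictly increasing on L
below-strict : ∀ L {a b} → a ∈ L → a < b → below L a < below L b
below-strict (a ∷ L) {b = b} (here refl) a<b = begin-strict
  below (a ∷ L) a  ≡⟨ below-∷-≮ L (<-irrefl refl) ⟩
  below L a        <⟨ s≤s (below-mono L (<⇒≤ a<b)) ⟩
  suc (below L b)  ≡⟨ below-∷-< L a<b ⟨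
  below (a ∷ L) b  ∎
  where open ≤-Reasoning
below-strict (y ∷ L) {a} {b} (there a∈L) a<b with y <? a | y <? b
... | yes y<a | yes y<b rewrite below-∷-< L y<a | below-∷-< L y<b = s≤s (below-strict L a∈L a<b)
... | yes y<a | no y≮b = contradiction (<-trans y<a a<b) y≮b
... | no y≮a | yes y<b rewrite below-∷-≮ L y≮a | below-∷-< L y<b = m≤n⇒m≤1+n (below-strict L a∈L a<b)
... | no y≮a | no y≮b rewrite below-∷-≮ L y≮a | below-∷-≮ L y≮b = below-strict L a∈L a<b

below-map-suc : ∀ L c → below (map suc L) (suc c) ≡ below L c
below-map-suc [] c = refl
below-map-suc (y ∷ L) c with y <? c
... | yes y<c rewrite below-∷-< (map suc L) (s≤s y<c) | below-∷-< L y<c = cong suc (below-map-suc L c)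
... | no y≮c rewrite below-∷-≮ (map suc L) (y≮c ∘ s≤s⁻¹) | below-∷-≮ L y≮c = below-map-suc L c

below-↭ : ∀ {L L'} c → L ↭ L' → below L c ≡ below L' c
below-↭ c L↭L' = ↭-length (filter-↭ (_<? c) L↭L')

below-upTo : ∀ n i → i ≤ n → below (upTo n) i ≡ i
below-upTo n zero _ = below-zero (upTo n)
below-upTo (suc n) (suc i) (s≤s i≤n) = begin
  below (upTo (suc n)) (suc i)           ≡⟨ below-∷-< (applyUpTo suc n) (s≤s z≤n) ⟩
  suc (below (applyUpTo suc n) (suc i))  ≡⟨ cong (λ L → suc (below L (suc i))) (map-upTo suc n) ⟨
  suc (below (map suc (upTo n)) (suc i)) ≡⟨ cong suc (below-map-suc (upTo n) i) ⟩
  suc (below (upTo n) i)                 ≡⟨ cong suc (below-upTo n i i≤n) ⟩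
  suc i                                  ∎
  where open ≡-Reasoning

st-perm : ∀ n {L} → IsPerm n L → st L ≡ L
st-perm n {L} L↭ = map-id-local (All-resp-↭ (↭-sym L↭) (All-map⁺ (applyUpTo⁺₁ (λ i → i) n fixes)))
  where
  fixes : ∀ {i} → i < n → suc (below L (suc i)) ≡ suc i
  fixes {i} i<n = cong suc (begin
    below L (suc i)                  ≡⟨ below-↭ (suc i) L↭ ⟩
    below (map suc (upTo n)) (suc i) ≡⟨ below-map-suc (upTo n) i ⟩
    below (upTo n) i                 ≡⟨ below-upTo n i (<⇒≤ i<n) ⟩
    i                                ∎)
    where open ≡-Reasoning

st-map-suc : ∀ L → st (map suc L) ≡ st L
st-map-suc L = begin
  map (λ c → suc (below (map suc L) c)) (map suc L)  ≡⟨ map-∘ L ⟨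
  map (λ c → suc (below (map suc L) (suc c))) L      ≡⟨ map-cong (λ c → cong suc (below-map-suc L c)) L ⟩
  map (λ c → suc (below L c)) L                      ∎
  where open ≡-Reasoning

updown : List ℕ → List Bool
updown [] = []
updown (x ∷ []) = []
updown (x ∷ y ∷ xs) = does (x <? y) ∷ updown (y ∷ xs)

updown-map : ∀ (f : ℕ → ℕ) → (∀ {a b} → a ≤ b → f a ≤ f b) →
  ∀ ys → All (λ a → ∀ {b} → a < b → f a < f b) ys → updown (map f ys) ≡ updown ys
updown-map f mono [] _ = refl
updown-map f mono (x ∷ []) _ = refl
updown-map f mono (x ∷ y ∷ ys) (strict-x ∷ strict-ys) =
  cong₂ _∷_ same-letter (updown-map f mono (y ∷ ys) strict-ys)
  where
  same-letter : does (f x <? f y) ≡ does (x <? y)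
  same-letter with x <? y
  ... | yes x<y = trans (dec-true (f x <? f y) (strict-x x<y)) (sym (dec-true (x <? y) x<y))
  ... | no x≮y = trans (dec-false (f x <? f y) (≤⇒≯ (mono (≮⇒≥ x≮y)))) (sym (dec-false (x <? y) x≮y))

updown-st : ∀ L → updown (st L) ≡ updown L
updown-st L = updown-map (λ c → suc (below L c)) (s≤s ∘ below-mono L) L
  (All.tabulate (λ a∈L a<b → s≤s (below-strict L a∈L a<b)))

updown-take : ∀ k xs → updown (take (suc k) xs) ≡ take k (updown xs)
updown-take k [] = sym (take-[] k)
updown-take zero (x ∷ []) = refl
updown-take (suc k) (x ∷ []) = refl
updown-take zero (x ∷ y ∷ xs) = refl
updown-take (suc k) (x ∷ y ∷ xs) = cong (does (x <? y) ∷_) (updown-take k (y ∷ xs))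

updown-drop : ∀ xs → updown (drop 1 xs) ≡ drop 1 (updown xs)
updown-drop [] = refl
updown-drop (x ∷ []) = refl
updown-drop (x ∷ y ∷ xs) = refl

Shift : ℕ → List Bool → List Bool → Set
Shift N p q = ∃ λ P → p ≡ take N P × q ≡ drop 1 P

edge-shift : ∀ N {x w} → Edge (suc N) x w → Shift N (updown x) (updown w)
edge-shift N (c , _ , refl , refl) =
  updown c , trans (updown-st (take (suc N) c)) (updown-take N c) ,
             trans (updown-st (drop 1 c)) (updown-drop c)

Constant : Bool → List Bool → Set
Constant b = All (_≡ b)

shift-forward : ∀ {N b p q} → Shift (suc N) p q → Constant b p → Constant b (take N q)
shift-forward {N} {b} (P , refl , refl) c = subst (Constant b) (sym (take-drop N 1 P)) (drop⁺ 1 c)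

drop-take : ∀ s N (xs : List Bool) → drop s (take N xs) ≡ take (N ∸ s) (drop s xs)
drop-take zero N xs = refl
drop-take (suc s) zero xs = refl
drop-take (suc s) (suc N) [] = sym (take-[] (N ∸ s))
drop-take (suc s) (suc N) (x ∷ xs) = drop-take s N xs

shift-backward : ∀ {N b p q} s → Shift N p q → Constant b (drop s q) → Constant b (drop (suc s) p)
shift-backward {N} {b} s (P , refl , refl) c =
  subst (Constant b) (sym (drop-take (suc s) N P)) (take⁺ (N ∸ suc s) (subst (Constant b) (drop-drop 1 s P) c))

constant-split : ∀ {b} i j p → i ≤ j → Constant b (take j p) → Constant b (drop i p) → Constant b p
constant-split zero j p _ _ constant-suffix = constant-suffix
constant-split (suc i) (suc j) [] _ _ _ = []
constant-split (suc i) (suc j) (x ∷ p) (s≤s i≤j) (x≡b ∷ constant-prefix) constant-suffix =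
  x≡b ∷ constant-split i j p i≤j constant-prefix constant-suffix

take-cons-fixed : ∀ N h Q → take N (h ∷ Q) ≡ Q → Constant h Q
take-cons-fixed N h [] _ = []
take-cons-fixed zero h (q ∷ Q) ()
take-cons-fixed (suc N) h (q ∷ Q) eq with ∷-injective eq
... | refl , eq' = refl ∷ take-cons-fixed N h Q eq'

shift-self-constant : ∀ {N p} → Shift N p p → ∃ λ b → Constant b p
shift-self-constant ([] , _ , refl) = true , []
shift-self-constant {N} (h ∷ Q , eq , refl) = h , take-cons-fixed N h Q (sym eq)

propagate-backward : ∀ {N b} (p : ℕ → List Bool) → (∀ t → Shift N (p t) (p (suc t))) →
  ∀ d t → Constant b (p (d + t)) → Constant b (drop d (p t))
propagate-backward p shifts zero t c = c
propagate-backward {b = b} p shifts (suc d) t c = shift-backward d (shifts t)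
  (propagate-backward p shifts d (suc t) (subst (Constant b ∘ p) (sym (+-suc d t)) c))

constant-next : ∀ {N b} (p : ℕ → List Bool) → (∀ t → Shift (suc N) (p t) (p (suc t))) →
  ∀ m → m ≤ N → p (suc m) ≡ p 0 → Constant b (p 0) → Constant b (p 1)
constant-next {N} {b} p shifts m m≤N period c₀ =
  constant-split m N (p 1) m≤N (shift-forward (shifts 0) c₀)
    (propagate-backward p shifts m 1 (subst (Constant b ∘ p) (sym (+-comm m 1)) (subst (Constant b) (sym period) c₀)))

Step : Bool → ℕ → ℕ → Set
Step b x y = does (x <? y) ≡ b

constant⇒linked : ∀ {b} xs → Constant b (updown xs) → Linked (Step b) xs
constant⇒linked [] _ = []
constant⇒linked (x ∷ []) _ = [-]
constant⇒linked (x ∷ y ∷ xs) (step ∷ steps) = step ∷ constant⇒linked (y ∷ xs) steps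

linked⇒constant : ∀ {b xs} → Linked (Step b) xs → Constant b (updown xs)
linked⇒constant [] = []
linked⇒constant [-] = []
linked⇒constant (step ∷ steps) = step ∷ linked⇒constant steps

ascent⇒≤ : ∀ {x y} → Step true x y → x ≤ y
ascent⇒≤ {x} {y} ascent = <⇒≤ (<ᵇ⇒< x y (subst T (sym ascent) tt))

descent⇒≥ : ∀ {x y} → Step false x y → y ≤ x
descent⇒≥ {x} {y} descent = ≮⇒≥ (λ x<y → true≢false (trans (sym (dec-true (x <? y) x<y)) descent))
  where
  true≢false : true ≢ false
  true≢false ()

-- two b-monotone sequences which are permutations of each other coincide,
-- being sorted for ≤ (b = true) or for ≥ (b = false)
monotone-unique : ∀ b {xs ys} → Linked (Step b) xs → Linked (Step b) ys → xs ↭ ys → xs ≡ ys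
monotone-unique true xs-mono ys-mono xs↭ys = ≋⇒≡ (↗↭↗⇒≋ ≤-totalOrder
  (Linked.map ascent⇒≤ xs-mono) (Linked.map ascent⇒≤ ys-mono) (↭⇒↭ₛ xs↭ys))
monotone-unique false xs-mono ys-mono xs↭ys = ≋⇒≡ (↗↭↗⇒≋ (TotalOrderProperties.≥-totalOrder ≤-totalOrder)
  (Linked.map descent⇒≥ xs-mono) (Linked.map descent⇒≥ ys-mono) (↭⇒↭ₛ xs↭ys))

monotonePerm : Bool → ℕ → List ℕ
monotonePerm true n = idPerm n
monotonePerm false n = revPerm n

idPerm≡applyUpTo : ∀ n → idPerm n ≡ applyUpTo suc n
idPerm≡applyUpTo = map-upTo suc

revPerm≡applyDownFrom : ∀ n → revPerm n ≡ applyDownFrom suc n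
revPerm≡applyDownFrom n = trans (cong reverse (idPerm≡applyUpTo n)) (reverse-applyUpTo suc n)

linked-applyUpTo : ∀ {R : ℕ → ℕ → Set} f → (∀ i → R (f i) (f (suc i))) → ∀ n → Linked R (applyUpTo f n)
linked-applyUpTo f step zero = []
linked-applyUpTo f step (suc zero) = [-]
linked-applyUpTo f step (suc (suc n)) = step 0 ∷ linked-applyUpTo (f ∘ suc) (step ∘ suc) (suc n)

linked-applyDownFrom : ∀ {R : ℕ → ℕ → Set} f → (∀ i → R (f (suc i)) (f i)) → ∀ n → Linked R (applyDownFrom f n)
linked-applyDownFrom f step zero = []
linked-applyDownFrom f step (suc zero) = [-]
linked-applyDownFrom f step (suc (suc n)) = step n ∷ linked-applyDownFrom f step (suc n)

monotonePerm-linked : ∀ b n → Linked (Step b) (monotonePerm b n)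
monotonePerm-linked true n = subst (Linked (Step true)) (sym (idPerm≡applyUpTo n))
  (linked-applyUpTo suc (λ i → dec-true (suc i <? suc (suc i)) (n<1+n (suc i))) n)
monotonePerm-linked false n = subst (Linked (Step false)) (sym (revPerm≡applyDownFrom n))
  (linked-applyDownFrom suc (λ i → dec-false (suc (suc i) <? suc i) (<-asym (n<1+n (suc i)))) n)

monotonePerm-isPerm : ∀ b n → IsPerm n (monotonePerm b n)
monotonePerm-isPerm true n = ↭-refl
monotonePerm-isPerm false n = ↭-reverse (idPerm n)

monotone-constant : ∀ b n → Constant b (updown (monotonePerm b n))
monotone-constant b n = linked⇒constant (monotonePerm-linked b n)

constant-perm : ∀ b n {x} → IsPerm n x → Constant b (updown x) → x ≡ monotonePerm b n
constant-perm b n {x} x↭ constant = monotone-unique b (constant⇒linked x constant) (monotonePerm-linked b n)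
  (↭-trans x↭ (↭-sym (monotonePerm-isPerm b n)))

take-applyUpTo : ∀ (f : ℕ → ℕ) n → take n (applyUpTo f (suc n)) ≡ applyUpTo f n
take-applyUpTo f zero = refl
take-applyUpTo f (suc n) = cong (f 0 ∷_) (take-applyUpTo (f ∘ suc) n)

take-applyDownFrom : ∀ (f : ℕ → ℕ) n → take n (applyDownFrom f (suc n)) ≡ applyDownFrom (f ∘ suc) n
take-applyDownFrom f zero = refl
take-applyDownFrom f (suc n) = cong (f (suc n) ∷_) (take-applyDownFrom f n)

idPerm-windows : ∀ n → take n (idPerm (suc n)) ≡ idPerm n × drop 1 (idPerm (suc n)) ≡ map suc (idPerm n)
idPerm-windows n =
  trans (cong (take n) (idPerm≡applyUpTo (suc n))) (trans (take-applyUpTo suc n) (sym (idPerm≡applyUpTo n))) ,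
  cong (map suc) (sym (idPerm≡applyUpTo n))

revPerm-windows : ∀ n → take n (revPerm (suc n)) ≡ map suc (revPerm n) × drop 1 (revPerm (suc n)) ≡ revPerm n
revPerm-windows n =
  trans (cong (take n) (revPerm≡applyDownFrom (suc n)))
    (trans (take-applyDownFrom suc n) (trans (sym (map-applyDownFrom suc suc n)) (cong (map suc) (sym (revPerm≡applyDownFrom n))))) ,
  trans (cong (drop 1) (revPerm≡applyDownFrom (suc n))) (sym (revPerm≡applyDownFrom n))

-- the edge c = monotonePerm b (n+1) is a loop at monotonePerm b n
monotone-loop : ∀ b n → Edge n (monotonePerm b n) (monotonePerm b n)
monotone-loop true n with idPerm-windows n
... | first , last = idPerm (suc n) , ↭-refl ,
  trans (cong st first) (st-perm n ↭-refl) ,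
  trans (cong st last) (trans (st-map-suc (idPerm n)) (st-perm n ↭-refl))
monotone-loop false n with revPerm-windows n
... | first , last = revPerm (suc n) , monotonePerm-isPerm false (suc n) ,
  trans (cong st first) (trans (st-map-suc (revPerm n)) (st-perm n (monotonePerm-isPerm false n))) ,
  trans (cong st last) (st-perm n (monotonePerm-isPerm false n))

loop⇔monotone : ∀ N {x} → IsPerm (suc N) x → Edge (suc N) x x ⇔ (x ≡ idPerm (suc N) ⊎ x ≡ revPerm (suc N))
loop⇔monotone N {x} x↭ = mk⇔ loop⇒monotone monotone⇒loop
  where
  loop⇒monotone : Edge (suc N) x x → x ≡ idPerm (suc N) ⊎ x ≡ revPerm (suc N)
  loop⇒monotone loop with shift-self-constant (edge-shift N loop)
  ... | true , constant = inj₁ (constant-perm true (suc N) x↭ constant)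
  ... | false , constant = inj₂ (constant-perm false (suc N) x↭ constant)
  monotone⇒loop : x ≡ idPerm (suc N) ⊎ x ≡ revPerm (suc N) → Edge (suc N) x x
  monotone⇒loop (inj₁ refl) = monotone-loop true (suc N)
  monotone⇒loop (inj₂ refl) = monotone-loop false (suc N)

one-cycle⇔loop : ∀ n {x} → IsPerm n x → InCycle n 1 x ⇔ Edge n x x
one-cycle⇔loop n {x} x↭ = mk⇔ cycle⇒loop loop⇒cycle
  where
  cycle⇒loop : InCycle n 1 x → Edge n x x
  cycle⇒loop (v , ((_ , _ , closing) , _) , zero , refl) = closing
  loop⇒cycle : Edge n x x → InCycle n 1 x
  loop⇒cycle loop = (λ _ → x) , (((λ _ → x↭) , (λ ()) , loop) , single-index) , zero , refl
    where
    single-index : ∀ {i j : Fin 1} → x ≡ x → i ≡ j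
    single-index {zero} {zero} _ = refl

data LastOrInner : (m : ℕ) → Fin (suc m) → Set where
  last : ∀ {m} → LastOrInner m (fromℕ m)
  inner : ∀ {m} (i : Fin m) → LastOrInner m (inject₁ i)

lastOrInner : ∀ {m} (j : Fin (suc m)) → LastOrInner m j
lastOrInner {zero} zero = last
lastOrInner {suc m} zero = inner zero
lastOrInner {suc m} (suc j) with lastOrInner j
... | last = last
... | inner i = inner (suc i)

successor : ∀ {m j} → LastOrInner m j → Fin (suc m)
successor last = zero
successor (inner i) = suc i

next : ∀ {m} → Fin (suc m) → Fin (suc m)
next j = successor (lastOrInner j)

walk-step : ∀ {n m v} → IsClosedWalk n m v → ∀ j → Edge n (v j) (v (next j))
walk-step {v = v} (_ , steps , closing) j = step (lastOrInner j)
  where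
  step : ∀ {j} (view : LastOrInner _ j) → Edge _ (v j) (v (successor view))
  step last = closing
  step (inner i) = steps i

next-moves : ∀ {m} (j : Fin (suc (suc m))) → next j ≢ j
next-moves j = moves (lastOrInner j)
  where
  moves : ∀ {m j} (view : LastOrInner (suc m) j) → successor view ≢ j
  moves last ()
  moves (inner i) eq = 1+n≢n (trans (cong toℕ eq) (toℕ-inject₁ i))

toℕ-next : ∀ {m} (j : Fin (suc m)) → toℕ j < m → toℕ (next j) ≡ suc (toℕ j)
toℕ-next {m} j = step (lastOrInner j)
  where
  step : ∀ {j} (view : LastOrInner m j) → toℕ j < m → toℕ (successor view) ≡ suc (toℕ j)
  step last j<m = contradiction (subst (_< m) (toℕ-fromℕ m) j<m) (<-irrefl refl)
  step (inner i) _ = cong suc (sym (toℕ-inject₁ i))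

next-wraps : ∀ {m} (j : Fin (suc m)) → toℕ j ≡ m → next j ≡ zero
next-wraps {m} j = wraps (lastOrInner j)
  where
  wraps : ∀ {j} (view : LastOrInner m j) → toℕ j ≡ m → successor view ≡ zero
  wraps last _ = refl
  wraps (inner i) j≡m = contradiction (trans (sym (toℕ-inject₁ i)) j≡m) (<⇒≢ (toℕ<n i))

orbit : ∀ {m} → Fin (suc m) → ℕ → Fin (suc m)
orbit j zero = j
orbit j (suc t) = next (orbit j t)

orbit-+ : ∀ {m} (j : Fin (suc m)) a b → orbit j (a + b) ≡ orbit (orbit j b) a
orbit-+ j zero b = refl
orbit-+ j (suc a) b = cong next (orbit-+ j a b)

toℕ-orbit-zero : ∀ {m} t → t ≤ m → toℕ (orbit {m} zero t) ≡ t
toℕ-orbit-zero zero _ = refl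
toℕ-orbit-zero (suc t) t<m = trans (toℕ-next _ (subst (_< _) (sym previous) t<m)) (cong suc previous)
  where
  previous = toℕ-orbit-zero t (<⇒≤ t<m)

orbit-period : ∀ {m} (j : Fin (suc m)) → orbit j (suc m) ≡ j
orbit-period {m} j = begin
  orbit j (suc m)                        ≡⟨ cong (λ i → orbit i (suc m)) start ⟨
  orbit (orbit zero (toℕ j)) (suc m)     ≡⟨ orbit-+ zero (suc m) (toℕ j) ⟨
  orbit zero (suc m + toℕ j)             ≡⟨ cong (orbit zero) (+-comm (suc m) (toℕ j)) ⟩
  orbit zero (toℕ j + suc m)             ≡⟨ orbit-+ zero (toℕ j) (suc m) ⟩
  orbit (orbit zero (suc m)) (toℕ j)     ≡⟨ cong (λ i → orbit i (toℕ j)) wrap ⟩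
  orbit zero (toℕ j)                     ≡⟨ start ⟩
  j                                      ∎
  where
  open ≡-Reasoning
  start : orbit zero (toℕ j) ≡ j
  start = toℕ-injective (toℕ-orbit-zero (toℕ j) (<⇒≤pred (toℕ<n j)))
  wrap : orbit zero (suc m) ≡ zero
  wrap = next-wraps (orbit zero m) (toℕ-orbit-zero m ≤-refl)

no-short-cycle : ∀ N m b → suc m ≤ N → ¬ InCycle (suc (suc N)) (suc (suc m)) (monotonePerm b (suc (suc N)))
no-short-cycle N m b m<N (v , ((walk@(perms , _) , injective) , i , vᵢ≡x)) =
  next-moves i (injective (trans v-next≡x (sym vᵢ≡x)))
  where
  pattern-at : ℕ → List Bool
  pattern-at t = updown (v (orbit i t))

  shifts : ∀ t → Shift (suc N) (pattern-at t) (pattern-at (suc t))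
  shifts t = edge-shift (suc N) (walk-step walk (orbit i t))

  constant-now : Constant b (pattern-at 0)
  constant-now = subst (Constant b ∘ updown) (sym vᵢ≡x) (monotone-constant b _)

  constant-next-vertex : Constant b (pattern-at 1)
  constant-next-vertex = constant-next pattern-at shifts (suc m) m<N
    (cong (updown ∘ v) (orbit-period i)) constant-now

  v-next≡x : v (next i) ≡ monotonePerm b (suc (suc N))
  v-next≡x = constant-perm b _ (perms (next i)) constant-next-vertex

theorem3p6 : (n : ℕ) → 2 ≤ n →
    ((x : List ℕ) → IsPerm n x → (InCycle n 1 x ⇔ (x ≡ idPerm n ⊎ x ≡ revPerm n)))
    × ((k : ℕ) → 2 ≤ k → k < n → ¬ InCycle n k (idPerm n) × ¬ InCycle n k (revPerm n))
theorem3p6 (suc (suc N)) (s≤s (s≤s z≤n)) = loops , short-cycles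
  where
  loops : (x : List ℕ) → IsPerm (suc (suc N)) x →
    InCycle (suc (suc N)) 1 x ⇔ (x ≡ idPerm (suc (suc N)) ⊎ x ≡ revPerm (suc (suc N)))
  loops x x↭ = loop⇔monotone (suc N) x↭ ⇔-∘ one-cycle⇔loop (suc (suc N)) x↭
  short-cycles : (k : ℕ) → 2 ≤ k → k < suc (suc N) →
    ¬ InCycle (suc (suc N)) k (idPerm (suc (suc N))) × ¬ InCycle (suc (suc N)) k (revPerm (suc (suc N)))
  short-cycles (suc (suc m)) (s≤s (s≤s z≤n)) (s≤s (s≤s m<N)) = no-short-cycle N m true m<N , no-short-cycle N m false m<N
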